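{- Let $q\ge 4$ and let $M$ be a maximal independent set of chambers of $\mathrm{PG}(3,q)$. Then every $M$-line of $M$-weight two meets every $M$-line of $M$-weight larger than two.
   Context: $\mathrm{PG}(3,q)$ is the projective $3$-space over the field with $q$ elements. A chamber is a triple $(P,\ell,\pi)$ of a point, a line and a plane with $P\in\ell\subseteq\pi$. Two chambers $(P_1,\ell_1,\pi_1)$, $(P_2,\ell_2,\pi_2)$ are opposite if $P_1\notin\pi_2$, $P_2\notin\pi_1$ and $\ell_1,\ell_2$ are skew. An independent set is a set of pairwise non-opposite chambers; maximal means not properly contained in another independent set. The $M$-weight of a line is the number of chambers of $M$ containing it; an $M$-line is a line occurring in some chamber of $M$. Two lines meet if they are equal or share a point. -}

module Defs where

open import Level using (0ℓ)
open import Data.Nat using (ℕ; zero; suc)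
open import Data.Fin using (Fin)
import Data.Fin as Fin
open import Data.Product using (Σ; ∃; ∃-syntax; _×_; _,_)
open import Data.Sum using (_⊎_)
open import Relation.Nullary using (¬_)
open import Relation.Binary.PropositionalEquality using (_≡_; _≢_)
open import Algebra.Core using (Op₁; Op₂)
import Algebra.Structures as S

-- A field with exactly q elements, with carrier Fin q (every finite
-- field of order q is isomorphic to one of these).

record FieldOn (q : ℕ) : Set where
  field
    _+_ _*_ : Op₂ (Fin q)
    -_      : Op₁ (Fin q)
    0# 1#   : Fin q
    isCommutativeRing : S.IsCommutativeRing {A = Fin q} _≡_ _+_ _*_ -_ 0# 1#
    0≢1     : 0# ≢ 1#
    inverse : ∀ x → x ≢ 0# → ∃[ y ] (x * y ≡ 1#)

module PG3 {q : ℕ} (F : FieldOn q) where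
  open FieldOn F

  K : Set
  K = Fin q

  V4 : Set
  V4 = Fin 4 → K

  sumK : (k : ℕ) → (Fin k → K) → K
  sumK zero    f = 0#
  sumK (suc k) f = f Fin.zero + sumK k (λ i → f (Fin.suc i))

  comb : {k : ℕ} → (Fin k → K) → (Fin k → V4) → V4
  comb {k} a u j = sumK k (λ i → a i * u i j)

  _∈Span_ : {k : ℕ} → V4 → (Fin k → V4) → Set
  v ∈Span u = ∃[ a ] (∀ j → v j ≡ comb a u j)

  LinIndep : {k : ℕ} → (Fin k → V4) → Set
  LinIndep {k} u = ∀ a → (∀ j → comb a u j ≡ 0#) → ∀ i → a i ≡ 0#

  record Sub (k : ℕ) : Set where
    constructor sub
    field
      basis : Fin k → V4
      indep : LinIndep basis
  open Sub public

  _⊆S_ : {k m : ℕ} → Sub k → Sub m → Set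
  S ⊆S T = ∀ i → basis S i ∈Span basis T

  _≐_ : {k m : ℕ} → Sub k → Sub m → Set
  S ≐ T = S ⊆S T × T ⊆S S

  Point Line Plane : Set
  Point = Sub 1
  Line  = Sub 2
  Plane = Sub 3

  record Chamber : Set where
    constructor chamber
    field
      pt   : Point
      ln   : Line
      pl   : Plane
      pt⊆ln : pt ⊆S ln
      ln⊆pl : ln ⊆S pl
  open Chamber public

  _≈C_ : Chamber → Chamber → Set
  C ≈C D = (pt C ≐ pt D) × (ln C ≐ ln D) × (pl C ≐ pl D)

  Meet : Line → Line → Set
  Meet ℓ ℓ' = Σ Point λ P → (P ⊆S ℓ × P ⊆S ℓ')

  Skew : Line → Line → Set
  Skew ℓ ℓ' = ¬ Meet ℓ ℓ'

  Opposite : Chamber → Chamber → Set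
  Opposite C D = ¬ (pt C ⊆S pl D) × ¬ (pt D ⊆S pl C) × Skew (ln C) (ln D)

  ChamberSet : Set₁
  ChamberSet = Chamber → Set

  WellDefined : ChamberSet → Set
  WellDefined M = ∀ {C D} → C ≈C D → M C → M D

  Independent : ChamberSet → Set
  Independent M = ∀ {C D} → M C → M D → ¬ Opposite C D

  MaximalIndependent : ChamberSet → Set₁
  MaximalIndependent M =
    Independent M ×
    (∀ (N : ChamberSet) → (∀ {C} → M C → N C) → Independent N →
       ∀ {C} → N C → M C)

  _∋_ : Chamber → Line → Set
  C ∋ ℓ = ln C ≐ ℓ

  MLine : ChamberSet → Line → Set
  MLine M ℓ = ∃[ C ] (M C × C ∋ ℓ)

  Weight2 : ChamberSet → Line → Set
  Weight2 M ℓ =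
    ∃[ C₁ ] ∃[ C₂ ] (M C₁ × M C₂ × C₁ ∋ ℓ × C₂ ∋ ℓ × ¬ (C₁ ≈C C₂) ×
      (∀ C → M C → C ∋ ℓ → (C ≈C C₁) ⊎ (C ≈C C₂)))

  WeightGt2 : ChamberSet → Line → Set
  WeightGt2 M ℓ =
    ∃[ C₁ ] ∃[ C₂ ] ∃[ C₃ ] (M C₁ × M C₂ × M C₃ ×
      C₁ ∋ ℓ × C₂ ∋ ℓ × C₃ ∋ ℓ ×
      ¬ (C₁ ≈C C₂) × ¬ (C₁ ≈C C₃) × ¬ (C₂ ≈C C₃))

{-# OPTIONS --safe #-}
-- Suppose ℓ and ℓ' were skew, and let (A, ℓ, α) and (B, ℓ, β) be the two chambers of M on ℓ.
-- A chamber D = (Q, m, ρ) of M with m skew to ℓ is opposite to neither, so A ∈ ρ or Q ∈ α,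
-- and B ∈ ρ or Q ∈ β.  If A = B, then α ≠ β and (A, ℓ, π) for a third plane π ⊇ ℓ is
-- opposite to no chamber of M, so by maximality ℓ would carry a third chamber; dually if
-- α = β, with a third point of ℓ.  If A ≠ B and α ≠ β, every chamber of M on ℓ' satisfies
-- A ∈ ρ, Q ∈ β or B ∈ ρ, Q ∈ α (A, B ∈ ρ would make ℓ, ℓ' coplanar, Q ∈ α ∩ β = ℓ would make
-- them meet), and each alternative pins the chamber down (ρ = ⟨A, ℓ'⟩, Q = ℓ' ∩ β), so ℓ'
-- carries at most two chambers.  Meeting is decidable over a finite field, so refuting
-- skewness suffices; the dimension arguments all reduce to Steinitz exchange, proved by
-- Gaussian elimination.
module Submission where

open import Defs
open import Level using (0ℓ)
open import Data.Nat using (ℕ; zero; suc; _≤_)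
open import Data.Fin using (Fin; zero; suc; punchIn)
open import Data.Fin.Properties using (_≟_; any?; all?; ¬∀⟶∃¬)
open import Data.Vec.Functional using (_∷_; []; insertAt)
open import Data.Vec.Functional.Properties using (insertAt-lookup; insertAt-punchIn)
open import Data.Product using (Σ; ∃; ∃-syntax; _×_; _,_; proj₁; proj₂)
open import Data.Empty using (⊥)
open import Data.Sum using (_⊎_; inj₁; inj₂; [_,_]′)
open import Function using (_∘_)
open import Relation.Nullary using (¬_; Dec; yes; no; contradiction)
open import Relation.Nullary.Decidable using (¬?; _×-dec_; map′; ¬¬-excluded-middle; decidable-stable)
open import Relation.Binary.PropositionalEquality
open import Algebra.Bundles using (CommutativeRing)

module _ {q : ℕ} (F : FieldOn q) where
  open FieldOn F renaming (_+_ to infixl 6 _+_; _*_ to infixl 7 _*_; -_ to infix 8 -_)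
  open PG3 F
  open ≡-Reasoning

  ring : CommutativeRing 0ℓ 0ℓ
  ring = record { isCommutativeRing = isCommutativeRing }

  open CommutativeRing ring using
    ( +-comm; +-assoc; +-identityˡ; +-identityʳ; -‿inverseˡ
    ; *-comm; *-assoc; *-identityˡ; zeroˡ; zeroʳ; distribˡ )
  open import Algebra.Properties.Ring (CommutativeRing.ring ring)
    using (-‿distribˡ-*; -‿distribʳ-*; -1*x≈-x)
  open import Algebra.Properties.AbelianGroup (CommutativeRing.+-abelianGroup ring)
    using (xyx⁻¹≈y; inverseˡ-unique)
  open import Algebra.Properties.Semiring.Sum (CommutativeRing.semiring ring)
    using (sum; sum-cong-≋; sum-replicate-zero; sum-remove; ∑-distrib-+; ∑-comm; *-distribˡ-sum; *-distribʳ-sum)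
  open import Algebra.Solver.Ring.NaturalCoefficients.Default
    (CommutativeRing.commutativeSemiring ring)

  -- Field arithmetic and finite sums

  inverse-cancelˡ : ∀ {x y} z → x * y ≡ 1# → y * (x * z) ≡ z
  inverse-cancelˡ {x} {y} z xy≡1 = begin
    y * (x * z) ≡⟨ solve 3 (λ x y z → y :* (x :* z) := x :* y :* z) refl x y z ⟩
    x * y * z   ≡⟨ cong (_* z) xy≡1 ⟩
    1# * z      ≡⟨ *-identityˡ z ⟩
    z           ∎

  x*y≡0⇒y≡0 : ∀ {x y} → x ≢ 0# → x * y ≡ 0# → y ≡ 0#
  x*y≡0⇒y≡0 {x} {y} x≢0 xy≡0 with inverse x x≢0
  ... | x⁻¹ , xx⁻¹≡1 = begin
    y             ≡⟨ inverse-cancelˡ y xx⁻¹≡1 ⟨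
    x⁻¹ * (x * y) ≡⟨ cong (x⁻¹ *_) xy≡0 ⟩
    x⁻¹ * 0#      ≡⟨ zeroʳ x⁻¹ ⟩
    0#            ∎

  x+y-y≡x : ∀ x y → x + y + - y ≡ x
  x+y-y≡x x y = trans (cong (_+ - y) (+-comm x y)) (xyx⁻¹≈y y x)

  sumK≡sum : ∀ k (f : Fin k → K) → sumK k f ≡ sum f
  sumK≡sum zero    f = refl
  sumK≡sum (suc k) f = cong (f zero +_) (sumK≡sum k (f ∘ suc))

  sumK-cong : ∀ k {f g : Fin k → K} → (∀ i → f i ≡ g i) → sumK k f ≡ sumK k g
  sumK-cong k {f} {g} f≗g rewrite sumK≡sum k f | sumK≡sum k g = sum-cong-≋ f≗g

  sumK-zero : ∀ k {f : Fin k → K} → (∀ i → f i ≡ 0#) → sumK k f ≡ 0#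
  sumK-zero k {f} f≗0 rewrite sumK≡sum k f = trans (sum-cong-≋ f≗0) (sum-replicate-zero k)

  sumK-distrib-+ : ∀ k (f g : Fin k → K) → sumK k (λ i → f i + g i) ≡ sumK k f + sumK k g
  sumK-distrib-+ k f g
    rewrite sumK≡sum k (λ i → f i + g i) | sumK≡sum k f | sumK≡sum k g = ∑-distrib-+ f g

  *-distribˡ-sumK : ∀ k x (f : Fin k → K) → x * sumK k f ≡ sumK k (λ i → x * f i)
  *-distribˡ-sumK k x f rewrite sumK≡sum k f | sumK≡sum k (λ i → x * f i) = *-distribˡ-sum x f

  *-distribʳ-sumK : ∀ k x (f : Fin k → K) → sumK k f * x ≡ sumK k (λ i → f i * x)
  *-distribʳ-sumK k x f rewrite sumK≡sum k f | sumK≡sum k (λ i → f i * x) = *-distribʳ-sum x f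

  -‿distrib-sumK : ∀ k (f : Fin k → K) → - sumK k f ≡ sumK k (λ i → - f i)
  -‿distrib-sumK k f = begin
    - sumK k f                ≡⟨ -1*x≈-x (sumK k f) ⟨
    - 1# * sumK k f           ≡⟨ *-distribˡ-sumK k (- 1#) f ⟩
    sumK k (λ i → - 1# * f i) ≡⟨ sumK-cong k (λ i → -1*x≈-x (f i)) ⟩
    sumK k (λ i → - f i)      ∎

  sumK-comm : ∀ k m (f : Fin k → Fin m → K) →
    sumK k (λ i → sumK m (f i)) ≡ sumK m (λ j → sumK k (λ i → f i j))
  sumK-comm k m f = begin
    sumK k (λ i → sumK m (f i))        ≡⟨ sumK-cong k (λ i → sumK≡sum m (f i)) ⟩
    sumK k (λ i → sum (f i))           ≡⟨ sumK≡sum k _ ⟩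
    sum (λ i → sum (f i))              ≡⟨ ∑-comm f ⟩
    sum (λ j → sum (λ i → f i j))      ≡⟨ sumK≡sum m _ ⟨
    sumK m (λ j → sum (λ i → f i j))   ≡⟨ sumK-cong m (λ j → sumK≡sum k (λ i → f i j)) ⟨
    sumK m (λ j → sumK k (λ i → f i j)) ∎

  sumK-remove : ∀ k (r : Fin (suc k)) (f : Fin (suc k) → K) →
    sumK (suc k) f ≡ f r + sumK k (f ∘ punchIn r)
  sumK-remove k r f = begin
    sumK (suc k) f               ≡⟨ sumK≡sum (suc k) f ⟩
    sum f                        ≡⟨ sum-remove {i = r} f ⟩
    f r + sum (f ∘ punchIn r)    ≡⟨ cong (f r +_) (sumK≡sum k (f ∘ punchIn r)) ⟨
    f r + sumK k (f ∘ punchIn r) ∎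

  δ : ∀ {k} → Fin k → Fin k → K
  δ zero    zero    = 1#
  δ zero    (suc _) = 0#
  δ (suc _) zero    = 0#
  δ (suc i) (suc j) = δ i j

  δ-diagonal : ∀ {k} (i : Fin k) → δ i i ≡ 1#
  δ-diagonal zero    = refl
  δ-diagonal (suc i) = δ-diagonal i

  sumK-δ : ∀ k (i : Fin k) (g : Fin k → K) → sumK k (λ j → δ i j * g j) ≡ g i
  sumK-δ (suc k) zero g = begin
    1# * g zero + sumK k (λ j → 0# * g (suc j)) ≡⟨ cong₂ _+_ (*-identityˡ _) (sumK-zero k (λ j → zeroˡ _)) ⟩
    g zero + 0#                                 ≡⟨ +-identityʳ _ ⟩
    g zero                                      ∎
  sumK-δ (suc k) (suc i) g = begin
    0# * g zero + sumK k (λ j → δ i j * g (suc j)) ≡⟨ cong₂ _+_ (zeroˡ _) (sumK-δ k i (g ∘ suc)) ⟩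
    0# + g (suc i)                                 ≡⟨ +-identityˡ _ ⟩
    g (suc i)                                      ∎

  -- Linear algebra in F⁴

  TrivialKernel : (k m : ℕ) → (Fin k → Fin m → K) → Set
  TrivialKernel k m c =
    (a : Fin k → K) → (∀ j → sumK k (λ i → a i * c i j) ≡ 0#) → ∀ i → a i ≡ 0#

  TrivialKernel-dropZeroColumn : ∀ k (c : Fin (suc (suc k)) → Fin (suc k) → K) →
    (∀ r → c r zero ≡ 0#) → TrivialKernel (suc (suc k)) (suc k) c →
    TrivialKernel (suc k) k (λ i j → c (suc i) (suc j))
  TrivialKernel-dropZeroColumn k c column≡0 trivial a solves i = trivial (0# ∷ a) lifted (suc i)
    where
    lifted : ∀ j → sumK (suc (suc k)) (λ i → (0# ∷ a) i * c i j) ≡ 0#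
    lifted zero    = trans (cong₂ _+_ (zeroˡ _) (sumK-zero (suc k) (λ i →
                       trans (cong (a i *_) (column≡0 (suc i))) (zeroʳ _)))) (+-identityˡ 0#)
    lifted (suc j) = trans (cong₂ _+_ (zeroˡ _) (solves j)) (+-identityˡ 0#)

  -- One step of Gaussian elimination on the first column, pivoting on row r.
  eliminate : ∀ {k m} → Fin (suc k) → (Fin (suc k) → Fin (suc m) → K) → Fin k → Fin m → K
  eliminate r c i j = c r zero * c (punchIn r i) (suc j) + - (c (punchIn r i) zero * c r (suc j))

  -- Lifts a solution of the eliminated system; the pivot coordinate cancels the first column.
  backSubstitute : ∀ {k m} → Fin (suc k) → (Fin (suc k) → Fin (suc m) → K) → (Fin k → K) → Fin (suc k) → K
  backSubstitute {k} r c a = insertAt (λ i → c r zero * a i) r (- sumK k (λ i → a i * c (punchIn r i) zero))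

  sumK-backSubstitute : ∀ {k m} (r : Fin (suc k)) (c : Fin (suc k) → Fin (suc m) → K) (a : Fin k → K) (j : Fin (suc m)) →
    sumK (suc k) (λ x → backSubstitute r c a x * c x j) ≡
    - sumK k (λ i → a i * c (punchIn r i) zero) * c r j + c r zero * sumK k (λ i → a i * c (punchIn r i) j)
  sumK-backSubstitute {k} r c a j = begin
    sumK (suc k) (λ x → b x * c x j)                                ≡⟨ sumK-remove k r (λ x → b x * c x j) ⟩
    b r * c r j + sumK k (λ i → b (punchIn r i) * c (punchIn r i) j) ≡⟨ cong₂ _+_ (cong (_* c r j) b-pivot) (sumK-cong k b-other) ⟩
    - s * c r j + sumK k (λ i → p * (a i * c (punchIn r i) j))       ≡⟨ cong (- s * c r j +_) (*-distribˡ-sumK k p _) ⟨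
    - s * c r j + p * sumK k (λ i → a i * c (punchIn r i) j)         ∎
    where
    b = backSubstitute r c a
    p = c r zero
    s = sumK k (λ i → a i * c (punchIn r i) zero)
    b-pivot : b r ≡ - s
    b-pivot = insertAt-lookup (λ i → p * a i) r (- s)
    b-other : ∀ i → b (punchIn r i) * c (punchIn r i) j ≡ p * (a i * c (punchIn r i) j)
    b-other i = trans (cong (_* c (punchIn r i) j) (insertAt-punchIn (λ i → p * a i) r (- s) i))
                      (*-assoc p (a i) (c (punchIn r i) j))

  sumK-eliminate : ∀ {k m} (r : Fin (suc k)) (c : Fin (suc k) → Fin (suc m) → K) (a : Fin k → K) (j : Fin m) →
    sumK k (λ i → a i * eliminate r c i j) ≡
    c r zero * sumK k (λ i → a i * c (punchIn r i) (suc j)) + - (c r (suc j) * sumK k (λ i → a i * c (punchIn r i) zero))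
  sumK-eliminate {k} r c a j = begin
    sumK k (λ i → a i * eliminate r c i j)          ≡⟨ sumK-cong k expand ⟩
    sumK k (λ i → pX i + - ZY i)                    ≡⟨ sumK-distrib-+ k pX (λ i → - ZY i) ⟩
    sumK k pX + sumK k (λ i → - ZY i)               ≡⟨ cong (sumK k pX +_) (-‿distrib-sumK k ZY) ⟨
    sumK k pX + - sumK k ZY                         ≡⟨ cong₂ (λ u v → u + - v) (*-distribˡ-sumK k p aX) (*-distribˡ-sumK k Z aY) ⟨
    p * sumK k aX + - (Z * sumK k aY)               ∎
    where
    p = c r zero
    Z = c r (suc j)
    aX aY pX ZY : Fin k → K
    aX i = a i * c (punchIn r i) (suc j)
    aY i = a i * c (punchIn r i) zero
    pX i = p * aX i
    ZY i = Z * aY i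
    expand : ∀ i → a i * eliminate r c i j ≡ pX i + - ZY i
    expand i = begin
      a i * (p * X + - (Y * Z))         ≡⟨ distribˡ (a i) _ _ ⟩
      a i * (p * X) + a i * - (Y * Z)   ≡⟨ cong₂ _+_ (solve 3 (λ a p x → a :* (p :* x) := p :* (a :* x)) refl (a i) p X)
                                                     (sym (-‿distribʳ-* (a i) (Y * Z))) ⟩
      p * (a i * X) + - (a i * (Y * Z)) ≡⟨ cong (λ u → p * (a i * X) + - u)
                                                 (solve 3 (λ a y z → a :* (y :* z) := z :* (a :* y)) refl (a i) Y Z) ⟩
      p * (a i * X) + - (Z * (a i * Y)) ∎
      where
      X = c (punchIn r i) (suc j)
      Y = c (punchIn r i) zero

  backSubstitute-solves : ∀ {k m} (r : Fin (suc k)) (c : Fin (suc k) → Fin (suc m) → K) (a : Fin k → K) →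
    (∀ j → sumK k (λ i → a i * eliminate r c i j) ≡ 0#) →
    ∀ j → sumK (suc k) (λ x → backSubstitute r c a x * c x j) ≡ 0#
  backSubstitute-solves {k} r c a solves zero = begin
    sumK (suc k) (λ x → backSubstitute r c a x * c x zero) ≡⟨ sumK-backSubstitute r c a zero ⟩
    - s * p + p * s      ≡⟨ cong₂ _+_ (sym (-‿distribˡ-* s p)) (*-comm p s) ⟩
    - (s * p) + s * p    ≡⟨ -‿inverseˡ (s * p) ⟩
    0#                   ∎
    where
    p = c r zero
    s = sumK k (λ i → a i * c (punchIn r i) zero)
  backSubstitute-solves {k} r c a solves (suc j) = begin
    sumK (suc k) (λ x → backSubstitute r c a x * c x (suc j)) ≡⟨ sumK-backSubstitute r c a (suc j) ⟩
    - s * Z + p * T      ≡⟨ cong (_+ p * T) (sym (-‿distribˡ-* s Z)) ⟩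
    - (s * Z) + p * T    ≡⟨ +-comm _ _ ⟩
    p * T + - (s * Z)    ≡⟨ cong (λ u → p * T + - u) (*-comm s Z) ⟩
    p * T + - (Z * s)    ≡⟨ sumK-eliminate r c a j ⟨
    sumK k (λ i → a i * eliminate r c i j) ≡⟨ solves j ⟩
    0#                   ∎
    where
    p = c r zero
    Z = c r (suc j)
    s = sumK k (λ i → a i * c (punchIn r i) zero)
    T = sumK k (λ i → a i * c (punchIn r i) (suc j))

  TrivialKernel-eliminate : ∀ k (c : Fin (suc (suc k)) → Fin (suc k) → K) (r : Fin (suc (suc k))) →
    c r zero ≢ 0# → TrivialKernel (suc (suc k)) (suc k) c → TrivialKernel (suc k) k (eliminate r c)
  TrivialKernel-eliminate k c r pivot≢0 trivial a solves i = x*y≡0⇒y≡0 pivot≢0 (begin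
    c r zero * a i                      ≡⟨ insertAt-punchIn (λ i → c r zero * a i) r _ i ⟨
    backSubstitute r c a (punchIn r i)  ≡⟨ trivial (backSubstitute r c a) (backSubstitute-solves r c a solves) (punchIn r i) ⟩
    0#                                  ∎)

  TrivialKernel-underdetermined : ∀ k (c : Fin (suc k) → Fin k → K) → ¬ TrivialKernel (suc k) k c
  TrivialKernel-underdetermined zero c trivial = 0≢1 (sym (trivial (λ _ → 1#) (λ ()) zero))
  TrivialKernel-underdetermined (suc k) c trivial with any? (λ r → ¬? (c r zero ≟ 0#))
  ... | yes (r , pivot≢0) =
    TrivialKernel-underdetermined k (eliminate r c) (TrivialKernel-eliminate k c r pivot≢0 trivial)
  ... | no no-pivot =
    TrivialKernel-underdetermined k (λ i j → c (suc i) (suc j)) (TrivialKernel-dropZeroColumn k c column≡0 trivial)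
    where
    column≡0 : ∀ r → c r zero ≡ 0#
    column≡0 r = decidable-stable (c r zero ≟ 0#) (λ c≢0 → no-pivot (r , c≢0))

  comb-+ : ∀ {k} (a b : Fin k → K) (u : Fin k → V4) j →
    comb (λ i → a i + b i) u j ≡ comb a u j + comb b u j
  comb-+ {k} a b u j = begin
    sumK k (λ i → (a i + b i) * u i j)
      ≡⟨ sumK-cong k (λ i → solve 3 (λ a b u → (a :+ b) :* u := a :* u :+ b :* u) refl (a i) (b i) (u i j)) ⟩
    sumK k (λ i → a i * u i j + b i * u i j)   ≡⟨ sumK-distrib-+ k (λ i → a i * u i j) (λ i → b i * u i j) ⟩
    comb a u j + comb b u j                    ∎

  comb-- : ∀ {k} (a : Fin k → K) (u : Fin k → V4) j → comb (λ i → - a i) u j ≡ - comb a u j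
  comb-- {k} a u j = begin
    sumK k (λ i → - a i * u i j)     ≡⟨ sumK-cong k (λ i → -‿distribˡ-* (a i) (u i j)) ⟨
    sumK k (λ i → - (a i * u i j))   ≡⟨ -‿distrib-sumK k (λ i → a i * u i j) ⟨
    - comb a u j                     ∎

  comb-* : ∀ {k} c (a : Fin k → K) (u : Fin k → V4) j → comb (λ i → c * a i) u j ≡ c * comb a u j
  comb-* {k} c a u j = begin
    sumK k (λ i → c * a i * u i j)     ≡⟨ sumK-cong k (λ i → *-assoc c (a i) (u i j)) ⟩
    sumK k (λ i → c * (a i * u i j))   ≡⟨ *-distribˡ-sumK k c (λ i → a i * u i j) ⟨
    c * comb a u j                     ∎

  comb-comb : ∀ {k m} (a : Fin k → K) (c : Fin k → Fin m → K) (w : Fin m → V4) j →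
    comb a (λ i → comb (c i) w) j ≡ comb (λ l → sumK k (λ i → a i * c i l)) w j
  comb-comb {k} {m} a c w j = begin
    sumK k (λ i → a i * sumK m (λ l → c i l * w l j))
      ≡⟨ sumK-cong k (λ i → *-distribˡ-sumK m (a i) (λ l → c i l * w l j)) ⟩
    sumK k (λ i → sumK m (λ l → a i * (c i l * w l j)))
      ≡⟨ sumK-comm k m (λ i l → a i * (c i l * w l j)) ⟩
    sumK m (λ l → sumK k (λ i → a i * (c i l * w l j)))
      ≡⟨ sumK-cong m (λ l → sumK-cong k (λ i → sym (*-assoc (a i) (c i l) (w l j)))) ⟩
    sumK m (λ l → sumK k (λ i → a i * c i l * w l j))
      ≡⟨ sumK-cong m (λ l → *-distribʳ-sumK k (w l j) (λ i → a i * c i l)) ⟨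
    comb (λ l → sumK k (λ i → a i * c i l)) w j         ∎

  ∈Span-resp-≗ : ∀ {k} (w : Fin k → V4) {x y : V4} → (∀ t → x t ≡ y t) → x ∈Span w → y ∈Span w
  ∈Span-resp-≗ w x≗y (a , x≡aw) = a , λ t → trans (sym (x≗y t)) (x≡aw t)

  ∈Span-0 : ∀ {k} (w : Fin k → V4) {x : V4} → (∀ t → x t ≡ 0#) → x ∈Span w
  ∈Span-0 {k} w x≡0 = (λ _ → 0#) , λ t → trans (x≡0 t) (sym (sumK-zero k (λ i → zeroˡ (w i t))))

  ∈Span-+ : ∀ {k} (w : Fin k → V4) {x y : V4} → x ∈Span w → y ∈Span w → (λ t → x t + y t) ∈Span w
  ∈Span-+ w (a , x≡aw) (b , y≡bw) =
    (λ i → a i + b i) , λ t → trans (cong₂ _+_ (x≡aw t) (y≡bw t)) (sym (comb-+ a b w t))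

  ∈Span-- : ∀ {k} (w : Fin k → V4) {x : V4} → x ∈Span w → (λ t → - x t) ∈Span w
  ∈Span-- w (a , x≡aw) = (λ i → - a i) , λ t → trans (cong -_ (x≡aw t)) (sym (comb-- a w t))

  ∈Span-cancelˡ : ∀ {k} (w : Fin k → V4) {x y : V4} → x ∈Span w → (λ t → x t + y t) ∈Span w → y ∈Span w
  ∈Span-cancelˡ w {x} {y} x∈w x+y∈w =
    ∈Span-resp-≗ w (λ t → xyx⁻¹≈y (x t) (y t)) (∈Span-+ w x+y∈w (∈Span-- w x∈w))

  ∈Span-cancelʳ : ∀ {k} (w : Fin k → V4) {x y : V4} → y ∈Span w → (λ t → x t + y t) ∈Span w → x ∈Span w
  ∈Span-cancelʳ w {x} {y} y∈w x+y∈w =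
    ∈Span-resp-≗ w (λ t → x+y-y≡x (x t) (y t)) (∈Span-+ w x+y∈w (∈Span-- w y∈w))

  ∈Span-basis : ∀ {k} (u : Fin k → V4) i → u i ∈Span u
  ∈Span-basis {k} u i = δ i , λ t → sym (sumK-δ k i (λ j → u j t))

  ∈Span-trans : ∀ {k m} {x : V4} {u : Fin k → V4} (w : Fin m → V4) →
    x ∈Span u → (∀ i → u i ∈Span w) → x ∈Span w
  ∈Span-trans {k} {x = x} {u} w (a , x≡au) u⊆w =
    (λ l → sumK k (λ i → a i * c i l)) , λ t → begin
      x t                                         ≡⟨ x≡au t ⟩
      comb a u t                                  ≡⟨ sumK-cong k (λ i → cong (a i *_) (proj₂ (u⊆w i) t)) ⟩
      comb a (λ i → comb (c i) w) t               ≡⟨ comb-comb a c w t ⟩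
      comb (λ l → sumK k (λ i → a i * c i l)) w t ∎
    where
    c = λ i → proj₁ (u⊆w i)

  steinitz : ∀ k (u : Fin (suc k) → V4) (w : Fin k → V4) → (∀ i → u i ∈Span w) → ¬ LinIndep u
  steinitz k u w u⊆w u-indep = TrivialKernel-underdetermined k c trivial
    where
    c = λ i → proj₁ (u⊆w i)
    trivial : TrivialKernel (suc k) k c
    trivial a solves = u-indep a λ t → begin
      comb a u t                              ≡⟨ sumK-cong (suc k) (λ i → cong (a i *_) (proj₂ (u⊆w i) t)) ⟩
      comb a (λ i → comb (c i) w) t           ≡⟨ comb-comb a c w t ⟩
      comb (λ l → sumK (suc k) (λ i → a i * c i l)) w t
        ≡⟨ sumK-zero k (λ l → trans (cong (_* w l t) (solves l)) (zeroˡ _)) ⟩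
      0#                                      ∎

  LinIndep-∷ : ∀ {k} (u : Fin k → V4) {x : V4} → LinIndep u → ¬ x ∈Span u → LinIndep (x ∷ u)
  LinIndep-∷ {k} u {x} u-indep x∉u a relation with a zero ≟ 0#
  ... | yes a₀≡0 = λ { zero → a₀≡0 ; (suc i) → u-indep (a ∘ suc) rest i }
    where
    rest : ∀ t → comb (a ∘ suc) u t ≡ 0#
    rest t = begin
      comb (a ∘ suc) u t                ≡⟨ +-identityˡ _ ⟨
      0# + comb (a ∘ suc) u t           ≡⟨ cong (_+ comb (a ∘ suc) u t) 0≡a₀x ⟩
      a zero * x t + comb (a ∘ suc) u t ≡⟨ relation t ⟩
      0#                                ∎
      where
      0≡a₀x : 0# ≡ a zero * x t
      0≡a₀x = trans (sym (zeroˡ (x t))) (cong (_* x t) (sym a₀≡0))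
  ... | no a₀≢0 with inverse (a zero) a₀≢0
  ...   | y , a₀y≡1 = contradiction x∈u x∉u
    where
    x∈u : x ∈Span u
    x∈u = (λ i → y * - a (suc i)) , λ t → begin
      x t                                   ≡⟨ inverse-cancelˡ (x t) a₀y≡1 ⟨
      y * (a zero * x t)                    ≡⟨ cong (y *_) (inverseˡ-unique _ _ (relation t)) ⟩
      y * - comb (a ∘ suc) u t              ≡⟨ cong (y *_) (comb-- (a ∘ suc) u t) ⟨
      y * comb (λ i → - a (suc i)) u t      ≡⟨ comb-* y (λ i → - a (suc i)) u t ⟨
      comb (λ i → y * - a (suc i)) u t      ∎

  ¬¬-∀Fin : ∀ {n} {P : Fin n → Set} → (∀ i → ¬ ¬ P i) → ¬ ¬ (∀ i → P i)
  ¬¬-∀Fin {zero}  ¬¬P ¬∀P = ¬∀P (λ ())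
  ¬¬-∀Fin {suc n} ¬¬P ¬∀P =
    ¬¬P zero λ P₀ → ¬¬-∀Fin (¬¬P ∘ suc) λ P₊ → ¬∀P λ { zero → P₀ ; (suc i) → P₊ i }

  ¬¬∈Span-by-dimension : ∀ {k} (g t : Fin k → V4) → LinIndep g → (∀ i → g i ∈Span t) →
    ∀ {x} → x ∈Span t → ¬ ¬ (x ∈Span g)
  ¬¬∈Span-by-dimension {k} g t g-indep g⊆t {x} x∈t x∉g =
    steinitz k (x ∷ g) t (λ { zero → x∈t ; (suc i) → g⊆t i }) (LinIndep-∷ g g-indep x∉g)

  ¬¬⊆S-by-dimension : ∀ {k m} (g : Fin k → V4) → LinIndep g → (T : Sub k) (U : Sub m) →
    (∀ i → g i ∈Span basis T) → (∀ i → g i ∈Span basis U) → ¬ ¬ (T ⊆S U)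
  ¬¬⊆S-by-dimension g g-indep T U g⊆T g⊆U = ¬¬-∀Fin λ i T₍i₎∉U →
    ¬¬∈Span-by-dimension g (basis T) g-indep g⊆T (∈Span-basis (basis T) i) λ T₍i₎∈g →
      T₍i₎∉U (∈Span-trans (basis U) T₍i₎∈g g⊆U)

  zero-or-nonzero : (v : V4) → (∀ j → v j ≡ 0#) ⊎ (∃[ j ] v j ≢ 0#)
  zero-or-nonzero v with all? (λ j → v j ≟ 0#)
  ... | yes v≡0 = inj₁ v≡0
  ... | no  v≢0 = inj₂ (¬∀⟶∃¬ 4 _ (λ j → v j ≟ 0#) v≢0)

  ∉Span⇒nonzero : ∀ {k} (w : Fin k → V4) {v : V4} → ¬ v ∈Span w → ∃[ j ] v j ≢ 0#
  ∉Span⇒nonzero w {v} v∉w with zero-or-nonzero v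
  ... | inj₁ v≡0 = contradiction (∈Span-0 w v≡0) v∉w
  ... | inj₂ v≢0 = v≢0

  basis-nonzero : ∀ {k} (S : Sub k) i → ∃[ j ] basis S i j ≢ 0#
  basis-nonzero {k} S i with zero-or-nonzero (basis S i)
  ... | inj₂ b≢0 = b≢0
  ... | inj₁ b≡0 = contradiction (trans (sym (δ-diagonal i)) (indep S (δ i) δ-relation i)) (λ 1≡0 → 0≢1 (sym 1≡0))
    where
    δ-relation : ∀ t → comb (δ i) (basis S) t ≡ 0#
    δ-relation t = trans (sumK-δ k i (λ j → basis S j t)) (b≡0 t)

  pointOf : (v : V4) → ∃[ j ] v j ≢ 0# → Point
  pointOf v (j , vⱼ≢0) = sub (λ _ → v) v-indep
    where
    v-indep : LinIndep (λ _ → v)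
    v-indep a relation zero =
      x*y≡0⇒y≡0 vⱼ≢0 (trans (*-comm (v j) (a zero)) (trans (sym (+-identityʳ _)) (relation j)))

  pointOf-⊆S : ∀ {k} {v : V4} (v≢0 : ∃[ j ] v j ≢ 0#) (S : Sub k) → v ∈Span basis S → pointOf v v≢0 ⊆S S
  pointOf-⊆S v≢0 S v∈S zero = v∈S

  ⊆S-refl : ∀ {k} (S : Sub k) → S ⊆S S
  ⊆S-refl S = ∈Span-basis (basis S)

  ⊆S-trans : ∀ {k m n} {S : Sub k} {T : Sub m} {U : Sub n} → S ⊆S T → T ⊆S U → S ⊆S U
  ⊆S-trans {U = U} S⊆T T⊆U i = ∈Span-trans (basis U) (S⊆T i) T⊆U

  ≐-refl : ∀ {k} (S : Sub k) → S ≐ S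
  ≐-refl S = ⊆S-refl S , ⊆S-refl S

  ≐-sym : ∀ {k m} {S : Sub k} {T : Sub m} → S ≐ T → T ≐ S
  ≐-sym (S⊆T , T⊆S) = T⊆S , S⊆T

  ≐-trans : ∀ {k m n} {S : Sub k} {T : Sub m} {U : Sub n} → S ≐ T → T ≐ U → S ≐ U
  ≐-trans {S = S} {T} {U} (S⊆T , T⊆S) (T⊆U , U⊆T) =
    ⊆S-trans {S = S} {T} {U} S⊆T T⊆U , ⊆S-trans {S = U} {T} {S} U⊆T T⊆S

  Point-⊆S⇒≐ : {P Q : Point} → P ⊆S Q → P ≐ Q
  Point-⊆S⇒≐ {P} {Q} P⊆Q with P⊆Q zero | basis-nonzero P zero
  ... | c , p≡cq | j , pⱼ≢0 with inverse (c zero) c≢0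
    where
    c≢0 : c zero ≢ 0#
    c≢0 c≡0 = pⱼ≢0 (trans (p≡cq j) (trans (+-identityʳ _) (trans (cong (_* basis Q zero j) c≡0) (zeroˡ _))))
  ...   | c⁻¹ , cc⁻¹≡1 = P⊆Q , λ { zero → (λ _ → c⁻¹) , q≡c⁻¹p }
    where
    q≡c⁻¹p : ∀ t → basis Q zero t ≡ c⁻¹ * basis P zero t + 0#
    q≡c⁻¹p t = begin
      basis Q zero t                       ≡⟨ inverse-cancelˡ (basis Q zero t) cc⁻¹≡1 ⟨
      c⁻¹ * (c zero * basis Q zero t)      ≡⟨ cong (c⁻¹ *_) (trans (p≡cq t) (+-identityʳ _)) ⟨
      c⁻¹ * (basis P zero t)               ≡⟨ +-identityʳ _ ⟨
      c⁻¹ * basis P zero t + 0#            ∎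

  -- Incidence in PG(3, q)

  plane-unique : ∀ {ℓ : Line} {α β : Plane} {P : Point} →
    ℓ ⊆S α → ℓ ⊆S β → P ⊆S α → P ⊆S β → ¬ P ⊆S ℓ → ¬ ¬ (α ≐ β)
  plane-unique {ℓ} {α} {β} {P} ℓ⊆α ℓ⊆β P⊆α P⊆β P⊈ℓ α≉β =
    ¬¬⊆S-by-dimension g g-indep α β g⊆α g⊆β λ α⊆β →
    ¬¬⊆S-by-dimension g g-indep β α g⊆β g⊆α λ β⊆α → α≉β (α⊆β , β⊆α)
    where
    g : Fin 3 → V4
    g = basis P zero ∷ basis ℓ
    g-indep : LinIndep g
    g-indep = LinIndep-∷ (basis ℓ) (indep ℓ) (λ p∈ℓ → P⊈ℓ λ { zero → p∈ℓ })
    g⊆α : ∀ i → g i ∈Span basis α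
    g⊆α = λ { zero → P⊆α zero ; (suc i) → ℓ⊆α i }
    g⊆β : ∀ i → g i ∈Span basis β
    g⊆β = λ { zero → P⊆β zero ; (suc i) → ℓ⊆β i }

  line⊆S : ∀ {m} {ℓ : Line} {S : Sub m} {P Q : Point} →
    P ⊆S ℓ → Q ⊆S ℓ → ¬ P ≐ Q → P ⊆S S → Q ⊆S S → ¬ ¬ (ℓ ⊆S S)
  line⊆S {ℓ = ℓ} {S} {P} {Q} P⊆ℓ Q⊆ℓ P≉Q P⊆S Q⊆S =
    ¬¬⊆S-by-dimension g g-indep ℓ S (λ { zero → Q⊆ℓ zero ; (suc i) → P⊆ℓ i })
                                    (λ { zero → Q⊆S zero ; (suc i) → P⊆S i })
    where
    g : Fin 2 → V4
    g = basis Q zero ∷ basis P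
    g-indep : LinIndep g
    g-indep = LinIndep-∷ (basis P) (indep P) (λ q∈P → P≉Q (≐-sym {S = Q} {P} (Point-⊆S⇒≐ {Q} {P} λ { zero → q∈P })))

  Skew⇒LinIndep : ∀ {ℓ m : Line} → Skew ℓ m →
    LinIndep (basis ℓ zero ∷ basis ℓ (suc zero) ∷ basis m zero ∷ basis m (suc zero) ∷ [])
  Skew⇒LinIndep {ℓ} {m} ℓ∦m a relation = split (zero-or-nonzero v)
    where
    aℓ aₘ : Fin 2 → K
    aℓ = a zero ∷ a (suc zero) ∷ []
    aₘ = a (suc (suc zero)) ∷ a (suc (suc (suc zero))) ∷ []
    v w : V4
    v = comb aℓ (basis ℓ)
    w = comb aₘ (basis m)
    v+w≡0 : ∀ t → v t + w t ≡ 0#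
    v+w≡0 t = begin
      (x + (y + 0#)) + w t ≡⟨ cong (λ e → x + e + w t) (+-identityʳ y) ⟩
      x + y + w t          ≡⟨ +-assoc x y (w t) ⟩
      x + (y + w t)        ≡⟨ relation t ⟩
      0#                   ∎
      where
      x = a zero * basis ℓ zero t
      y = a (suc zero) * basis ℓ (suc zero) t
    split : (∀ t → v t ≡ 0#) ⊎ (∃[ j ] v j ≢ 0#) → ∀ i → a i ≡ 0#
    split (inj₁ v≡0) = λ
      { zero                   → indep ℓ aℓ v≡0 zero
      ; (suc zero)             → indep ℓ aℓ v≡0 (suc zero)
      ; (suc (suc zero))       → indep m aₘ w≡0 zero
      ; (suc (suc (suc zero))) → indep m aₘ w≡0 (suc zero) }
      where
      w≡0 : ∀ t → w t ≡ 0#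
      w≡0 t = trans (sym (+-identityˡ (w t))) (trans (cong (_+ w t) (sym (v≡0 t))) (v+w≡0 t))
    split (inj₂ v≢0) =
      contradiction (pointOf v v≢0 , pointOf-⊆S v≢0 ℓ (aℓ , λ _ → refl) , pointOf-⊆S v≢0 m v∈m) ℓ∦m
      where
      v∈m : v ∈Span basis m
      v∈m = (λ i → - aₘ i) , λ t → trans (inverseˡ-unique (v t) (w t) (v+w≡0 t)) (sym (comb-- aₘ (basis m) t))

  coplanar-meet : ∀ {ℓ m : Line} {π : Plane} → ℓ ⊆S π → m ⊆S π → ¬ ¬ Meet ℓ m
  coplanar-meet {ℓ} {m} {π} ℓ⊆π m⊆π ℓ∦m = steinitz 3 _ (basis π) ℓm⊆π (Skew⇒LinIndep {ℓ} {m} ℓ∦m)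
    where
    ℓm⊆π : ∀ i → (basis ℓ zero ∷ basis ℓ (suc zero) ∷ basis m zero ∷ basis m (suc zero) ∷ []) i ∈Span basis π
    ℓm⊆π zero                   = ℓ⊆π zero
    ℓm⊆π (suc zero)             = ℓ⊆π (suc zero)
    ℓm⊆π (suc (suc zero))       = m⊆π zero
    ℓm⊆π (suc (suc (suc zero))) = m⊆π (suc zero)

  basis-outside : ∀ {k} (T : Sub (suc k)) (w : Fin k → V4) → ¬ ¬ (∃[ i ] ¬ basis T i ∈Span w)
  basis-outside T w none =
    ¬¬-∀Fin (λ i Tᵢ∉w → none (i , Tᵢ∉w)) λ T⊆w → steinitz _ (basis T) w T⊆w (indep T)

  third-plane : ∀ {ℓ : Line} {α β : Plane} → ℓ ⊆S α → ℓ ⊆S β → ¬ α ≐ β →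
    ¬ ¬ (Σ Plane λ π → ℓ ⊆S π × ¬ π ⊆S α × ¬ π ⊆S β)
  third-plane {ℓ} {α} {β} ℓ⊆α ℓ⊆β α≉β none =
    basis-outside α (basis ℓ) λ { (i , αᵢ∉ℓ) →
    basis-outside β (basis ℓ) λ { (j , βⱼ∉ℓ) →
    none (through (∈Span-basis (basis α) i) αᵢ∉ℓ (∈Span-basis (basis β) j) βⱼ∉ℓ) } }
    where
    not-off-ℓ-in-both : ∀ {y} → y ∈Span basis α → y ∈Span basis β → ¬ ¬ y ∈Span basis ℓ
    not-off-ℓ-in-both {y} y∈α y∈β y∉ℓ =
      plane-unique {ℓ} {α} {β} {pointOf y y≢0} ℓ⊆α ℓ⊆β (pointOf-⊆S y≢0 α y∈α) (pointOf-⊆S y≢0 β y∈β)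
        (λ Y⊆ℓ → y∉ℓ (Y⊆ℓ zero)) α≉β
      where
      y≢0 = ∉Span⇒nonzero (basis ℓ) y∉ℓ
    through : ∀ {x y} → x ∈Span basis α → ¬ x ∈Span basis ℓ → y ∈Span basis β → ¬ y ∈Span basis ℓ →
      Σ Plane λ π → ℓ ⊆S π × ¬ π ⊆S α × ¬ π ⊆S β
    through {x} {y} x∈α x∉ℓ y∈β y∉ℓ = π , ℓ⊆π , (λ π⊆α → p∉α (π⊆α zero)) , (λ π⊆β → p∉β (π⊆β zero))
      where
      p : V4
      p t = x t + y t
      p∉α : ¬ p ∈Span basis α
      p∉α p∈α = not-off-ℓ-in-both (∈Span-cancelˡ (basis α) x∈α p∈α) y∈β y∉ℓ
      p∉β : ¬ p ∈Span basis β
      p∉β p∈β = not-off-ℓ-in-both x∈α (∈Span-cancelʳ (basis β) y∈β p∈β) x∉ℓ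
      π : Plane
      π = sub (p ∷ basis ℓ) (LinIndep-∷ (basis ℓ) (indep ℓ) (λ p∈ℓ → p∉α (∈Span-trans (basis α) p∈ℓ ℓ⊆α)))
      ℓ⊆π : ℓ ⊆S π
      ℓ⊆π i = ∈Span-basis (p ∷ basis ℓ) (suc i)

  third-point : ∀ {A B : Point} → ¬ A ≐ B →
    Σ Point λ P → ¬ P ⊆S A × ¬ P ⊆S B × (∀ {m} (S : Sub m) → A ⊆S S → B ⊆S S → P ⊆S S)
  third-point {A} {B} A≉B = build (zero-or-nonzero p)
    where
    a b p : V4
    a = basis A zero
    b = basis B zero
    p t = a t + b t
    b∉A : ¬ b ∈Span basis A
    b∉A b∈A = A≉B (≐-sym {S = B} {A} (Point-⊆S⇒≐ {B} {A} λ { zero → b∈A }))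
    a∉B : ¬ a ∈Span basis B
    a∉B a∈B = A≉B (Point-⊆S⇒≐ {A} {B} λ { zero → a∈B })
    build : (∀ t → p t ≡ 0#) ⊎ (∃[ j ] p j ≢ 0#) →
      Σ Point λ P → ¬ P ⊆S A × ¬ P ⊆S B × (∀ {m} (S : Sub m) → A ⊆S S → B ⊆S S → P ⊆S S)
    build (inj₁ p≡0) = contradiction (∈Span-cancelˡ (basis A) (∈Span-basis (basis A) zero) (∈Span-0 (basis A) p≡0)) b∉A
    build (inj₂ p≢0) = pointOf p p≢0 , P⊈A , P⊈B , P⊆
      where
      P⊈A : ¬ pointOf p p≢0 ⊆S A
      P⊈A P⊆A = b∉A (∈Span-cancelˡ (basis A) (∈Span-basis (basis A) zero) (P⊆A zero))
      P⊈B : ¬ pointOf p p≢0 ⊆S B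
      P⊈B P⊆B = a∉B (∈Span-cancelʳ (basis B) (∈Span-basis (basis B) zero) (P⊆B zero))
      P⊆ : ∀ {m} (S : Sub m) → A ⊆S S → B ⊆S S → pointOf p p≢0 ⊆S S
      P⊆ S A⊆S B⊆S = pointOf-⊆S p≢0 S (∈Span-+ (basis S) (A⊆S zero) (B⊆S zero))

  Meet-refl : (ℓ : Line) → Meet ℓ ℓ
  Meet-refl ℓ = P , P⊆ℓ , P⊆ℓ
    where
    P = pointOf (basis ℓ zero) (basis-nonzero ℓ zero)
    P⊆ℓ = pointOf-⊆S (basis-nonzero ℓ zero) ℓ (∈Span-basis (basis ℓ) zero)

  Meet-resp-⊆S : ∀ {ℓ ℓ₁ m m₁ : Line} → ℓ ⊆S ℓ₁ → m ⊆S m₁ → Meet ℓ m → Meet ℓ₁ m₁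
  Meet-resp-⊆S {ℓ} {ℓ₁} {m} {m₁} ℓ⊆ℓ₁ m⊆m₁ (P , P⊆ℓ , P⊆m) =
    P , ⊆S-trans {S = P} {ℓ} {ℓ₁} P⊆ℓ ℓ⊆ℓ₁ , ⊆S-trans {S = P} {m} {m₁} P⊆m m⊆m₁

  Skew-resp-⊆S : ∀ {ℓ ℓ₁ m m₁ : Line} → ℓ₁ ⊆S ℓ → m₁ ⊆S m → Skew ℓ m → Skew ℓ₁ m₁
  Skew-resp-⊆S {ℓ} {ℓ₁} {m} {m₁} ℓ₁⊆ℓ m₁⊆m ℓ∦m meet =
    ℓ∦m (Meet-resp-⊆S {ℓ₁} {ℓ} {m₁} {m} ℓ₁⊆ℓ m₁⊆m meet)

  ∋⇒pt⊆S : (C : Chamber) (ℓ : Line) → C ∋ ℓ → pt C ⊆S ℓ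
  ∋⇒pt⊆S C ℓ C∋ℓ = ⊆S-trans {S = pt C} {ln C} {ℓ} (pt⊆ln C) (proj₁ C∋ℓ)

  ∋⇒⊆S-pl : (C : Chamber) (ℓ : Line) → C ∋ ℓ → ℓ ⊆S pl C
  ∋⇒⊆S-pl C ℓ C∋ℓ = ⊆S-trans {S = ℓ} {ln C} {pl C} (proj₂ C∋ℓ) (ln⊆pl C)

  Opposite-sym : (C D : Chamber) → Opposite C D → Opposite D C
  Opposite-sym C D (C∉D , D∉C , C∦D) = D∉C , C∉D , λ { (P , P⊆D , P⊆C) → C∦D (P , P⊆C , P⊆D) }

  ¬Opposite⇒incident : (C D : Chamber) → ¬ Opposite C D → Skew (ln C) (ln D) →
    ¬ ¬ (pt C ⊆S pl D ⊎ pt D ⊆S pl C)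
  ¬Opposite⇒incident C D C≁D C∦D neither =
    C≁D ((λ C⊆D → neither (inj₁ C⊆D)) , (λ D⊆C → neither (inj₂ D⊆C)) , C∦D)

  maximal-absorbs : ∀ {M : ChamberSet} → MaximalIndependent M →
    (X : Chamber) → (∀ {D} → M D → ¬ Opposite X D) → M X
  maximal-absorbs {M} (M-indep , M-max) X compatible = M-max N inj₁ N-indep (inj₂ refl)
    where
    N : ChamberSet
    N C = M C ⊎ C ≡ X
    N-indep : Independent N
    N-indep (inj₁ C∈M)  (inj₁ D∈M)  = M-indep C∈M D∈M
    N-indep {C} (inj₁ C∈M) (inj₂ refl) = compatible C∈M ∘ Opposite-sym C X
    N-indep (inj₂ refl) (inj₁ D∈M)  = compatible D∈M
    N-indep (inj₂ refl) (inj₂ refl) (_ , _ , X∦X) = X∦X (Meet-refl (ln X))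

  -- Two skew lines

  module SkewLines (ℓ ℓ' : Line) (ℓ∦ℓ' : Skew ℓ ℓ') where

    Through : Point → Plane → Chamber → Set
    Through X γ D = X ⊆S pl D × pt D ⊆S γ

    Skew-on-ℓ' : (D : Chamber) → D ∋ ℓ' → Skew ℓ (ln D)
    Skew-on-ℓ' D D∋ℓ' = Skew-resp-⊆S {ℓ} {ℓ} {ℓ'} {ln D} (⊆S-refl ℓ) (proj₁ D∋ℓ') ℓ∦ℓ'

    -- The plane is ⟨X, ℓ'⟩ and the point is ℓ' ∩ γ.
    determined-on-ℓ' : (X : Point) (γ : Plane) → X ⊆S ℓ → ℓ ⊆S γ → (D D' : Chamber) →
      D ∋ ℓ' → D' ∋ ℓ' → Through X γ D → Through X γ D' → ¬ ¬ (D ≈C D')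
    determined-on-ℓ' X γ X⊆ℓ ℓ⊆γ D D' D∋ℓ' D'∋ℓ' (X⊆ρ , Q⊆γ) (X⊆ρ' , Q'⊆γ) D≉D' =
      ¬¬-excluded-middle {A = pt D ≐ pt D'} λ
        { (no Q≉Q') → line⊆S {ℓ = ℓ'} {γ} {pt D} {pt D'} (∋⇒pt⊆S D ℓ' D∋ℓ') (∋⇒pt⊆S D' ℓ' D'∋ℓ')
            Q≉Q' Q⊆γ Q'⊆γ
            λ ℓ'⊆γ → coplanar-meet {ℓ} {ℓ'} {γ} ℓ⊆γ ℓ'⊆γ ℓ∦ℓ'
        ; (yes Q≐Q') → plane-unique {ℓ'} {pl D} {pl D'} {X} (∋⇒⊆S-pl D ℓ' D∋ℓ') (∋⇒⊆S-pl D' ℓ' D'∋ℓ') X⊆ρ X⊆ρ'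
            (λ X⊆ℓ' → ℓ∦ℓ' (X , X⊆ℓ , X⊆ℓ'))
            λ ρ≐ρ' → D≉D' (Q≐Q' , ≐-trans {S = ln D} {ℓ'} {ln D'} D∋ℓ' (≐-sym {S = ln D'} {ℓ'} D'∋ℓ') ,
                           ρ≐ρ') }

    module WeightTwo {M : ChamberSet} (M-max : MaximalIndependent M) (C₁ C₂ : Chamber)
      (C₁∈M : M C₁) (C₂∈M : M C₂) (C₁∋ℓ : C₁ ∋ ℓ) (C₂∋ℓ : C₂ ∋ ℓ) where

      A B : Point
      A = pt C₁
      B = pt C₂
      α β : Plane
      α = pl C₁
      β = pl C₂

      A⊆ℓ : A ⊆S ℓ
      A⊆ℓ = ∋⇒pt⊆S C₁ ℓ C₁∋ℓ
      B⊆ℓ : B ⊆S ℓ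
      B⊆ℓ = ∋⇒pt⊆S C₂ ℓ C₂∋ℓ
      ℓ⊆α : ℓ ⊆S α
      ℓ⊆α = ∋⇒⊆S-pl C₁ ℓ C₁∋ℓ
      ℓ⊆β : ℓ ⊆S β
      ℓ⊆β = ∋⇒⊆S-pl C₂ ℓ C₂∋ℓ

      incident₁ : ∀ {D} → M D → Skew ℓ (ln D) → ¬ ¬ (A ⊆S pl D ⊎ pt D ⊆S α)
      incident₁ {D} D∈M ℓ∦D = ¬Opposite⇒incident C₁ D (proj₁ M-max C₁∈M D∈M)
        (Skew-resp-⊆S {ℓ} {ln C₁} {ln D} {ln D} (proj₁ C₁∋ℓ) (⊆S-refl (ln D)) ℓ∦D)

      incident₂ : ∀ {D} → M D → Skew ℓ (ln D) → ¬ ¬ (B ⊆S pl D ⊎ pt D ⊆S β)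
      incident₂ {D} D∈M ℓ∦D = ¬Opposite⇒incident C₂ D (proj₁ M-max C₂∈M D∈M)
        (Skew-resp-⊆S {ℓ} {ln C₂} {ln D} {ln D} (proj₁ C₂∋ℓ) (⊆S-refl (ln D)) ℓ∦D)

      not-on-both-planes : ¬ α ≐ β → (D : Chamber) → Skew ℓ (ln D) → pt D ⊆S α → pt D ⊆S β → ⊥
      not-on-both-planes α≉β D ℓ∦D Q⊆α Q⊆β = ¬¬-excluded-middle {A = pt D ⊆S ℓ} λ
        { (yes Q⊆ℓ) → ℓ∦D (pt D , Q⊆ℓ , pt⊆ln D)
        ; (no Q⊈ℓ)  → plane-unique {ℓ} {α} {β} {pt D} ℓ⊆α ℓ⊆β Q⊆α Q⊆β Q⊈ℓ α≉β }

      OnlyTwo : Set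
      OnlyTwo = ∀ C → M C → C ∋ ℓ → (C ≈C C₁) ⊎ (C ≈C C₂)

      same-point : OnlyTwo → A ≐ B → ¬ α ≐ β → ⊥
      same-point only-two A≐B α≉β = third-plane {ℓ} {α} {β} ℓ⊆α ℓ⊆β α≉β λ
        { (π , ℓ⊆π , π⊈α , π⊈β) →
          [ (λ X≈C₁ → π⊈α (proj₁ (proj₂ (proj₂ X≈C₁)))) , (λ X≈C₂ → π⊈β (proj₁ (proj₂ (proj₂ X≈C₂)))) ]′
            (only-two (X π ℓ⊆π) (maximal-absorbs M-max (X π ℓ⊆π) (compatible π ℓ⊆π)) (≐-refl ℓ)) }
        where
        X : (π : Plane) → ℓ ⊆S π → Chamber
        X π ℓ⊆π = chamber A ℓ π A⊆ℓ ℓ⊆π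
        compatible : (π : Plane) (ℓ⊆π : ℓ ⊆S π) → ∀ {D} → M D → ¬ Opposite (X π ℓ⊆π) D
        compatible π ℓ⊆π {D} D∈M (A⊈ρ , _ , ℓ∦D) = incident₁ D∈M ℓ∦D λ
          { (inj₁ A⊆ρ) → A⊈ρ A⊆ρ
          ; (inj₂ Q⊆α) → incident₂ D∈M ℓ∦D λ
            { (inj₁ B⊆ρ) → A⊈ρ (⊆S-trans {S = A} {B} {pl D} (proj₁ A≐B) B⊆ρ)
            ; (inj₂ Q⊆β) → not-on-both-planes α≉β D ℓ∦D Q⊆α Q⊆β } }

      same-plane : OnlyTwo → ¬ A ≐ B → α ≐ β → ⊥
      same-plane only-two A≉B α≐β with third-point {A} {B} A≉B
      ... | P , P⊈A , P⊈B , P⊆ =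
        [ (λ X≈C₁ → P⊈A (proj₁ (proj₁ X≈C₁))) , (λ X≈C₂ → P⊈B (proj₁ (proj₁ X≈C₂))) ]′
          (only-two X (maximal-absorbs M-max X compatible) (≐-refl ℓ))
        where
        X : Chamber
        X = chamber P ℓ α (P⊆ ℓ A⊆ℓ B⊆ℓ) ℓ⊆α
        compatible : ∀ {D} → M D → ¬ Opposite X D
        compatible {D} D∈M (P⊈ρ , Q⊈α , ℓ∦D) = incident₁ D∈M ℓ∦D λ
          { (inj₂ Q⊆α) → Q⊈α Q⊆α
          ; (inj₁ A⊆ρ) → incident₂ D∈M ℓ∦D λ
            { (inj₂ Q⊆β) → Q⊈α (⊆S-trans {S = pt D} {β} {α} Q⊆β (proj₂ α≐β))
            ; (inj₁ B⊆ρ) → P⊈ρ (P⊆ (pl D) A⊆ρ B⊆ρ) } }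

      classify : ¬ A ≐ B → ¬ α ≐ β → ∀ {D} → M D → D ∋ ℓ' → ¬ ¬ (Through A β D ⊎ Through B α D)
      classify A≉B α≉β {D} D∈M D∋ℓ' unclassified =
        incident₁ D∈M ℓ∦D λ r₁ → incident₂ D∈M ℓ∦D λ r₂ → sort r₁ r₂
        where
        ℓ∦D = Skew-on-ℓ' D D∋ℓ'
        sort : A ⊆S pl D ⊎ pt D ⊆S α → B ⊆S pl D ⊎ pt D ⊆S β → ⊥
        sort (inj₁ A⊆ρ) (inj₁ B⊆ρ) = line⊆S {ℓ = ℓ} {pl D} {A} {B} A⊆ℓ B⊆ℓ A≉B A⊆ρ B⊆ρ λ ℓ⊆ρ →
          coplanar-meet {ℓ} {ℓ'} {pl D} ℓ⊆ρ (∋⇒⊆S-pl D ℓ' D∋ℓ') ℓ∦ℓ'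
        sort (inj₁ A⊆ρ) (inj₂ Q⊆β) = unclassified (inj₁ (A⊆ρ , Q⊆β))
        sort (inj₂ Q⊆α) (inj₁ B⊆ρ) = unclassified (inj₂ (B⊆ρ , Q⊆α))
        sort (inj₂ Q⊆α) (inj₂ Q⊆β) = not-on-both-planes α≉β D ℓ∦D Q⊆α Q⊆β

      at-most-two : ¬ A ≐ B → ¬ α ≐ β → ¬ WeightGt2 M ℓ'
      at-most-two A≉B α≉β
        (D₁ , D₂ , D₃ , D₁∈M , D₂∈M , D₃∈M , D₁∋ℓ' , D₂∋ℓ' , D₃∋ℓ' , D₁≉D₂ , D₁≉D₃ , D₂≉D₃) =
        classify A≉B α≉β D₁∈M D₁∋ℓ' λ t₁ →
        classify A≉B α≉β D₂∈M D₂∋ℓ' λ t₂ →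
        classify A≉B α≉β D₃∈M D₃∋ℓ' λ t₃ → pigeonhole t₁ t₂ t₃
        where
        onA = determined-on-ℓ' A β A⊆ℓ ℓ⊆β
        onB = determined-on-ℓ' B α B⊆ℓ ℓ⊆α
        pigeonhole : Through A β D₁ ⊎ Through B α D₁ → Through A β D₂ ⊎ Through B α D₂ →
                     Through A β D₃ ⊎ Through B α D₃ → ⊥
        pigeonhole (inj₁ t₁) (inj₁ t₂) _         = onA D₁ D₂ D₁∋ℓ' D₂∋ℓ' t₁ t₂ D₁≉D₂
        pigeonhole (inj₂ t₁) (inj₂ t₂) _         = onB D₁ D₂ D₁∋ℓ' D₂∋ℓ' t₁ t₂ D₁≉D₂
        pigeonhole (inj₁ t₁) (inj₂ _)  (inj₁ t₃) = onA D₁ D₃ D₁∋ℓ' D₃∋ℓ' t₁ t₃ D₁≉D₃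
        pigeonhole (inj₂ t₁) (inj₁ _)  (inj₂ t₃) = onB D₁ D₃ D₁∋ℓ' D₃∋ℓ' t₁ t₃ D₁≉D₃
        pigeonhole (inj₁ _)  (inj₂ t₂) (inj₂ t₃) = onB D₂ D₃ D₂∋ℓ' D₃∋ℓ' t₂ t₃ D₂≉D₃
        pigeonhole (inj₂ _)  (inj₁ t₂) (inj₁ t₃) = onA D₂ D₃ D₂∋ℓ' D₃∋ℓ' t₂ t₃ D₂≉D₃

  meet? : (ℓ m : Line) → Dec (Meet ℓ m)
  meet? ℓ m = map′ witness⇒meet meet⇒witness
    (any? λ a₀ → any? λ a₁ → any? λ b₀ → any? λ b₁ → common? (a₀ ∷ a₁ ∷ []) (b₀ ∷ b₁ ∷ []))
    where
    Common : (Fin 2 → K) → (Fin 2 → K) → Set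
    Common a b = (∀ t → comb a (basis ℓ) t ≡ comb b (basis m) t) × ∃[ t ] comb a (basis ℓ) t ≢ 0#
    common? : ∀ a b → Dec (Common a b)
    common? a b = all? (λ t → comb a (basis ℓ) t ≟ comb b (basis m) t) ×-dec any? (λ t → ¬? (comb a (basis ℓ) t ≟ 0#))
    Witness : Set
    Witness = ∃ λ a₀ → ∃ λ a₁ → ∃ λ b₀ → ∃ λ b₁ → Common (a₀ ∷ a₁ ∷ []) (b₀ ∷ b₁ ∷ [])
    witness⇒meet : Witness → Meet ℓ m
    witness⇒meet (a₀ , a₁ , b₀ , b₁ , same , p≢0) =
      pointOf _ p≢0 ,
      pointOf-⊆S p≢0 ℓ ((a₀ ∷ a₁ ∷ []) , λ _ → refl) ,
      pointOf-⊆S p≢0 m ((b₀ ∷ b₁ ∷ []) , same)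
    meet⇒witness : Meet ℓ m → Witness
    meet⇒witness (P , P⊆ℓ , P⊆m) with P⊆ℓ zero | P⊆m zero | basis-nonzero P zero
    ... | a , p≡aℓ | b , p≡bm | j , pⱼ≢0 =
      a zero , a (suc zero) , b zero , b (suc zero) ,
      (λ t → trans (sym (p≡aℓ t)) (p≡bm t)) , j , λ aℓⱼ≡0 → pⱼ≢0 (trans (p≡aℓ j) aℓⱼ≡0)

  weight-two-meets-heavier : (M : ChamberSet) → MaximalIndependent M →
    (ℓ ℓ' : Line) → Weight2 M ℓ → WeightGt2 M ℓ' → Meet ℓ ℓ'
  weight-two-meets-heavier M M-max ℓ ℓ' (C₁ , C₂ , C₁∈M , C₂∈M , C₁∋ℓ , C₂∋ℓ , C₁≉C₂ , only-two) heavy =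
    decidable-stable (meet? ℓ ℓ') λ ℓ∦ℓ' →
      let open SkewLines.WeightTwo ℓ ℓ' ℓ∦ℓ' M-max C₁ C₂ C₁∈M C₂∈M C₁∋ℓ C₂∋ℓ in
      ¬¬-excluded-middle {A = A ≐ B} λ
        { (yes A≐B) → ¬¬-excluded-middle {A = α ≐ β} λ
            { (yes α≐β) → C₁≉C₂ (A≐B , ≐-trans {S = ln C₁} {ℓ} {ln C₂} C₁∋ℓ (≐-sym {S = ln C₂} {ℓ} C₂∋ℓ) ,
                                 α≐β)
            ; (no α≉β)  → same-point only-two A≐B α≉β }
        ; (no A≉B) → ¬¬-excluded-middle {A = α ≐ β} λ
            { (yes α≐β) → same-plane only-two A≉B α≐β
            ; (no α≉β)  → at-most-two A≉B α≉β heavy } }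

lemma5p6 : (q : ℕ) → 4 ≤ q → (F : FieldOn q) →
    let open PG3 F in
    (M : ChamberSet) → WellDefined M → MaximalIndependent M →
    (ℓ ℓ' : Line) → MLine M ℓ → MLine M ℓ' →
    Weight2 M ℓ → WeightGt2 M ℓ' → Meet ℓ ℓ'
lemma5p6 q _ F M _ M-max ℓ ℓ' _ _ = weight-two-meets-heavier F M M-max ℓ ℓ'
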